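{- Let $\Gamma$ be any algebraically closed directed graph that is not isomorphic to the countable universal directed graph $D$. Then there exists a non-regular injective endomorphism $f$ of $D$ such that the subgraph of $D$ induced by the images of the vertices under $f$ is isomorphic to $\Gamma$ and such that the $\mathscr{D}$-class of $f$ in $\operatorname{End} D$ contains $2^{\aleph_0}$ $\mathscr{R}$-classes and $2^{\aleph_0}$ $\mathscr{L}$-classes.
   Context: A directed graph is a pair $(V,E)$ with $E$ an irreflexive binary relation on $V$. A directed graph $(V,E)$ is algebraically closed if for every finite $A\subseteq V$ there is a vertex $v$ with $(u,v),(v,u)\in E$ for all $u\in A$. The countable universal directed graph $D$ is the Fraïssé limit of the finite directed graphs. The induced subgraph on a vertex set $U$ contains all edges of $D$ between vertices of $U$. Green's relations on $M=\operatorname{End} D$: $f\,\mathscr{L}\,g$ iff $Mf=Mg$; $f\,\mathscr{R}\,g$ iff $fM=gM$; $\mathscr{D}=\mathscr{L}\circ\mathscr{R}$. An element $f$ is regular if $fgf=f$ for some $g\in M$. -}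

module Defs where

open import Data.Nat using (ℕ; zero; suc; _<_; _/_; _%_)
open import Data.Bool using (Bool)
open import Data.List using (List)
open import Data.List.Relation.Unary.All using (All)
open import Data.Product using (Σ; ∃; _×_; _,_; proj₁)
open import Data.Sum using (_⊎_)
open import Relation.Nullary using (¬_)
open import Relation.Binary.PropositionalEquality using (_≡_)
open import Function.Base using (_∘_)

record Digraph : Set₁ where
  field
    V      : Set
    E      : V → V → Set
    irrefl : ∀ v → ¬ E v v
open Digraph public

AlgClosed : Digraph → Set
AlgClosed G = (A : List (V G)) → Σ (V G) λ v → All (λ u → E G u v × E G v u) A

Countable : Digraph → Set
Countable G = Σ (ℕ → V G) λ e → ∀ v → Σ ℕ λ n → e n ≡ v

record _≅_ (G H : Digraph) : Set where
  field
    to      : V G → V H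
    from    : V H → V G
    from∘to : ∀ v → from (to v) ≡ v
    to∘from : ∀ w → to (from w) ≡ w
    pres    : ∀ u v → E G u v → E H (to u) (to v)
    refl'   : ∀ u v → E H (to u) (to v) → E G u v

-- The countable universal directed graph D (a concrete model of the
-- Fraïssé limit of the finite directed graphs), on vertex set ℕ:
-- for m < n look at the m-th base-4 digit d of n;
--   d = 1 : edge m → n,  d = 2 : edge n → m,  d = 3 : both,  d = 0 : none.

shift4 : ℕ → ℕ → ℕ
shift4 zero    n = n
shift4 (suc m) n = shift4 m (n / 4)

digit : ℕ → ℕ → ℕ
digit m n = shift4 m n % 4

EdgeD : ℕ → ℕ → Set
EdgeD a b = (a < b × (digit a b ≡ 1 ⊎ digit a b ≡ 3))
          ⊎ (b < a × (digit b a ≡ 2 ⊎ digit b a ≡ 3))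

open import Data.Nat.Properties using (<-irrefl)
open import Relation.Binary.PropositionalEquality using (refl)
open import Data.Sum using (inj₁; inj₂)

EdgeD-irrefl : ∀ v → ¬ EdgeD v v
EdgeD-irrefl v (inj₁ (p , _)) = <-irrefl refl p
EdgeD-irrefl v (inj₂ (p , _)) = <-irrefl refl p

D : Digraph
D = record { V = ℕ ; E = EdgeD ; irrefl = EdgeD-irrefl }

record End : Set where
  field
    fun : ℕ → ℕ
    hom : ∀ a b → EdgeD a b → EdgeD (fun a) (fun b)
open End public

_≈_ : End → End → Set
f ≈ g = ∀ x → fun f x ≡ fun g x

_·_ : End → End → End
f · g = record { fun = fun f ∘ fun g
               ; hom = λ a b e → hom f _ _ (hom g a b e) }

_∈M·_ : End → End → Set
h ∈M· f = Σ End λ a → h ≈ (a · f)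

_∈·M_ : End → End → Set
h ∈·M f = Σ End λ a → h ≈ (f · a)

_𝓛_ : End → End → Set
f 𝓛 g = (∀ h → h ∈M· f → h ∈M· g) × (∀ h → h ∈M· g → h ∈M· f)

_𝓡_ : End → End → Set
f 𝓡 g = (∀ h → h ∈·M f → h ∈·M g) × (∀ h → h ∈·M g → h ∈·M f)

_𝓓_ : End → End → Set
f 𝓓 g = Σ End λ h → (f 𝓛 h) × (h 𝓡 g)

Regular : End → Set
Regular f = Σ End λ g → ((f · g) · f) ≈ f

Injective : End → Set
Injective f = ∀ x y → fun f x ≡ fun f y → x ≡ y

ImageSubgraph : End → Digraph
ImageSubgraph f = record
  { V = Σ ℕ (λ y → Σ ℕ λ x → fun f x ≡ y)
  ; E = λ u v → EdgeD (proj₁ u) (proj₁ v)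
  ; irrefl = λ u → EdgeD-irrefl (proj₁ u) }

-- "The 𝓓-class of f contains (at least) 2^ℵ₀ classes of the relation ρ":
-- a family indexed by Cantor space ℕ → Bool of elements of the 𝓓-class
-- of f, pairwise ρ-inequivalent for distinct indices.
ContinuumManyClassesIn𝓓 : (End → End → Set) → End → Set
ContinuumManyClassesIn𝓓 ρ f =
  Σ ((ℕ → Bool) → End) λ F →
    (∀ s → F s 𝓓 f) × (∀ s t → ρ (F s) (F t) → ∀ n → s n ≡ t n)

{-# OPTIONS --safe #-}
module Submission where

-- A back-and-forth argument (algebraic closedness of Γ in the forth steps, vertices of D
-- without edges to a given finite set in the back steps) yields a bijection φ : ℕ → V Γ
-- that is a homomorphism D → Γ.  Writing the edges of Γ, pulled back along φ, into base-4
-- digits gives an embedding f of Γ into D with sparse image.  If f g f = f then g ∘ f = id,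
-- so φ⁻¹ is a homomorphism too and Γ ≅ D: f is not regular.
-- Every vertex in the image of f carries a marker digit.  Recording s ∈ 2^ℕ in the markers
-- gives embeddings f_s with pairwise distinct images, so pairwise 𝓡-inequivalent, yet all
-- 𝓛-equivalent to f: a partial homomorphism defined on a sparse image extends to all of D
-- by sending the remaining vertices to hubs adjacent to everything below them.  Dually, let
-- ι embed D into itself with gaps and let β_s extend ι⁻¹, identifying the two vertices
-- after ι n exactly when s n holds.  Then f β_s ι = f gives f β_s 𝓡 f, while the kernels
-- of the f β_s are pairwise distinct, so they are pairwise 𝓛-inequivalent.

open import Defs
open import Axiom.ExcludedMiddle using (ExcludedMiddle)
open import Level using (0ℓ)
open import Data.Product using (Σ; _×_)
open import Relation.Nullary using (¬_)

open import Data.Bool using (Bool; true; false)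
open import Data.Bool.Properties using (⇔→≡; ¬-not)
open import Data.List using (List; []; _∷_; map)
open import Data.List.Extrema.Nat using (max; xs≤max)
open import Data.List.Membership.Propositional using (_∈_; _∉_)
open import Data.List.Relation.Binary.Subset.Propositional using (_⊆_)
open import Data.List.Relation.Unary.All using (lookup)
open import Data.List.Relation.Unary.All.Properties using (map⁻)
open import Data.List.Relation.Unary.Any using (here; there)
open import Data.Nat
open import Data.Nat.DivMod
open import Data.Nat.Divisibility using (divides-refl)
open import Data.Nat.Properties
open import Data.Product using (∃; _,_; proj₁; proj₂) renaming (swap to ×-swap)
open import Data.Sum using (_⊎_; inj₁; inj₂)
open import Function.Base using (_∘_)
open import Function.Bundles using (mk⇔)
open import Relation.Binary.Core using (_Preserves_⟶_)
open import Relation.Binary.Definitions using (Decidable; tri<; tri≈; tri>)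
open import Relation.Binary.PropositionalEquality
open import Relation.Nullary using (Dec; yes; no; contradiction)
open import Relation.Nullary.Decidable using (_×-dec_; _⊎-dec_)

consDigit : ℕ → ℕ → ℕ
consDigit d n = d % 4 + n * 4

consDigit/4 : ∀ d n → consDigit d n / 4 ≡ n
consDigit/4 d n = begin
  (d % 4 + n * 4) / 4    ≡⟨ +-distrib-/-∣ʳ (d % 4) (divides-refl n) ⟩
  d % 4 / 4 + n * 4 / 4  ≡⟨ cong₂ _+_ (m<n⇒m/n≡0 (m%n<n d 4)) (m*n/n≡m n 4) ⟩
  n                      ∎
  where open ≡-Reasoning

digit-consDigit-zero : ∀ d n → digit 0 (consDigit d n) ≡ d % 4
digit-consDigit-zero d n = trans ([m+kn]%n≡m%n (d % 4) n 4) (m%n%n≡m%n d 4)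

digit-consDigit-suc : ∀ k d n → digit (suc k) (consDigit d n) ≡ digit k n
digit-consDigit-suc k d n = cong (digit k) (consDigit/4 d n)

fromDigits : ℕ → (ℕ → ℕ) → ℕ
fromDigits zero    d = 0
fromDigits (suc N) d = consDigit (d 0) (fromDigits N (d ∘ suc))

digit-fromDigits : ∀ N d {k} → k < N → digit k (fromDigits N d) ≡ d k % 4
digit-fromDigits (suc N) d {zero}  _         = digit-consDigit-zero (d 0) (fromDigits N (d ∘ suc))
digit-fromDigits (suc N) d {suc k} (s≤s k<N) =
  trans (digit-consDigit-suc k (d 0) _) (digit-fromDigits N (d ∘ suc) k<N)

digit-of-zero : ∀ k → digit k 0 ≡ 0
digit-of-zero zero    = refl
digit-of-zero (suc k) = digit-of-zero k

digit-fromDigits-≥ : ∀ N d {k} → N ≤ k → digit k (fromDigits N d) ≡ 0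
digit-fromDigits-≥ zero    d {k}     _         = digit-of-zero k
digit-fromDigits-≥ (suc N) d {suc k} (s≤s N≤k) =
  trans (digit-consDigit-suc k (d 0) _) (digit-fromDigits-≥ N (d ∘ suc) N≤k)

digit-<4^ : ∀ k {n} → n < 4 ^ k → digit k n ≡ 0
digit-<4^ zero    {zero}  _         = refl
digit-<4^ zero    {suc n} (s≤s ())
digit-<4^ (suc k) {n}     n<4^[1+k] =
  digit-<4^ k (m<n*o⇒m/o<n (subst (n <_) (*-comm 4 (4 ^ k)) n<4^[1+k]))

1+n≤4*n : ∀ {n} → 1 ≤ n → suc n ≤ 4 * n
1+n≤4*n {n} 1≤n = subst (_≤ 4 * n) (+-comm n 1) (+-monoʳ-≤ n (≤-trans 1≤n (m≤m+n n _)))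

2+n<4^[1+n] : ∀ n → 2 + n < 4 ^ suc n
2+n<4^[1+n] zero    = s≤s (s≤s (s≤s z≤n))
2+n<4^[1+n] (suc n) = <-≤-trans (s≤s (2+n<4^[1+n] n)) (1+n≤4*n (m^n>0 4 (suc n)))

n<4^n : ∀ n → n < 4 ^ n
n<4^n zero    = s≤s z≤n
n<4^n (suc n) = <-trans (n<1+n (suc n)) (2+n<4^[1+n] n)

digit≢0⇒< : ∀ k n → digit k n ≢ 0 → k < n
digit≢0⇒< k n digit≢0 with n <? 4 ^ k
... | yes n<4^k = contradiction (digit-<4^ k n<4^k) digit≢0
... | no  n≮4^k = <-≤-trans (n<4^n k) (≮⇒≥ n≮4^k)

beyond : ℕ → ℕ → ℕ
beyond zero    a = 1
beyond (suc K) a = consDigit a (beyond K a)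

digit-beyond : ∀ K a {k} → k < K → digit k (beyond K a) ≡ a % 4
digit-beyond (suc K) a {zero}  _         = digit-consDigit-zero a (beyond K a)
digit-beyond (suc K) a {suc k} (s≤s k<K) =
  trans (digit-consDigit-suc k a (beyond K a)) (digit-beyond K a k<K)

digit-beyond-self : ∀ K a → digit K (beyond K a) ≡ 1
digit-beyond-self zero    a = refl
digit-beyond-self (suc K) a =
  trans (digit-consDigit-suc K a (beyond K a)) (digit-beyond-self K a)

<beyond : ∀ K a → K < beyond K a
<beyond K a = digit≢0⇒< K (beyond K a) (1+n≢0 ∘ trans (sym (digit-beyond-self K a)))

Forward Backward : ℕ → Set
Forward  d = d ≡ 1 ⊎ d ≡ 3
Backward d = d ≡ 2 ⊎ d ≡ 3

forward? : ∀ d → Dec (Forward d)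
forward? d = d ≟ 1 ⊎-dec d ≟ 3

backward? : ∀ d → Dec (Backward d)
backward? d = d ≟ 2 ⊎-dec d ≟ 3

forward⇒≢0 : ∀ {d} → Forward d → d ≢ 0
forward⇒≢0 (inj₁ refl) ()
forward⇒≢0 (inj₂ refl) ()

backward⇒≢0 : ∀ {d} → Backward d → d ≢ 0
backward⇒≢0 (inj₁ refl) ()
backward⇒≢0 (inj₂ refl) ()

EdgeD? : Decidable EdgeD
EdgeD? a b = (a <? b ×-dec forward? (digit a b)) ⊎-dec (b <? a ×-dec backward? (digit b a))

Adj : ℕ → ℕ → Set
Adj u v = EdgeD u v ⊎ EdgeD v u

Adj⇒digit≢0 : ∀ {u v} → Adj u v → (u < v × digit u v ≢ 0) ⊎ (v < u × digit v u ≢ 0)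
Adj⇒digit≢0 (inj₁ (inj₁ (u<v , fwd))) = inj₁ (u<v , forward⇒≢0 fwd)
Adj⇒digit≢0 (inj₁ (inj₂ (v<u , bwd))) = inj₂ (v<u , backward⇒≢0 bwd)
Adj⇒digit≢0 (inj₂ (inj₁ (v<u , fwd))) = inj₂ (v<u , forward⇒≢0 fwd)
Adj⇒digit≢0 (inj₂ (inj₂ (u<v , bwd))) = inj₁ (u<v , backward⇒≢0 bwd)

digit≡0⇒¬Adj : ∀ {u v} → u < v → digit u v ≡ 0 → ¬ Adj u v
digit≡0⇒¬Adj u<v digit≡0 adj with Adj⇒digit≢0 adj
... | inj₁ (_ , digit≢0) = digit≢0 digit≡0
... | inj₂ (v<u , _)     = <-asym u<v v<u

¬Adj-1+n-2+n : ∀ n → ¬ Adj (suc n) (suc (suc n))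
¬Adj-1+n-2+n n = digit≡0⇒¬Adj (n<1+n (suc n)) (digit-<4^ (suc n) (2+n<4^[1+n] n))

common : ℕ → ℕ
common K = beyond K 3

common-adj : ∀ {x} K → x < K → EdgeD x (common K) × EdgeD (common K) x
common-adj K x<K = inj₁ (x<common , inj₂ (digit-beyond K 3 x<K))
                 , inj₂ (x<common , inj₂ (digit-beyond K 3 x<K))
  where x<common = <-trans x<K (<beyond K 3)

isolated : ℕ → ℕ
isolated K = beyond K 0

isolated-¬Adj : ∀ {x} K → x < K → ¬ Adj x (isolated K)
isolated-¬Adj K x<K = digit≡0⇒¬Adj (<-trans x<K (<beyond K 0)) (digit-beyond K 0 x<K)

edgeCode : ∀ {P Q : Set} → Dec P → Dec Q → ℕ
edgeCode (yes _) (yes _) = 3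
edgeCode (yes _) (no _)  = 1
edgeCode (no _)  (yes _) = 2
edgeCode (no _)  (no _)  = 0

edgeCode%4 : ∀ {P Q : Set} (p : Dec P) (q : Dec Q) → edgeCode p q % 4 ≡ edgeCode p q
edgeCode%4 (yes _) (yes _) = refl
edgeCode%4 (yes _) (no _)  = refl
edgeCode%4 (no _)  (yes _) = refl
edgeCode%4 (no _)  (no _)  = refl

forward-edgeCode⁺ : ∀ {P Q : Set} (p : Dec P) (q : Dec Q) → P → Forward (edgeCode p q)
forward-edgeCode⁺ (yes _) (yes _) _  = inj₂ refl
forward-edgeCode⁺ (yes _) (no _)  _  = inj₁ refl
forward-edgeCode⁺ (no ¬P) _       P = contradiction P ¬P

forward-edgeCode⁻ : ∀ {P Q : Set} (p : Dec P) (q : Dec Q) → Forward (edgeCode p q) → P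
forward-edgeCode⁻ (yes P) _       _ = P
forward-edgeCode⁻ (no _)  (yes _) (inj₁ ())
forward-edgeCode⁻ (no _)  (yes _) (inj₂ ())
forward-edgeCode⁻ (no _)  (no _)  (inj₁ ())
forward-edgeCode⁻ (no _)  (no _)  (inj₂ ())

backward-edgeCode⁺ : ∀ {P Q : Set} (p : Dec P) (q : Dec Q) → Q → Backward (edgeCode p q)
backward-edgeCode⁺ (yes _) (yes _) _ = inj₂ refl
backward-edgeCode⁺ (no _)  (yes _) _ = inj₁ refl
backward-edgeCode⁺ _       (no ¬Q) Q = contradiction Q ¬Q

backward-edgeCode⁻ : ∀ {P Q : Set} (p : Dec P) (q : Dec Q) → Backward (edgeCode p q) → Q
backward-edgeCode⁻ _       (yes Q) _ = Q
backward-edgeCode⁻ (yes _) (no _)  (inj₁ ())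
backward-edgeCode⁻ (yes _) (no _)  (inj₂ ())
backward-edgeCode⁻ (no _)  (no _)  (inj₁ ())
backward-edgeCode⁻ (no _)  (no _)  (inj₂ ())

StrictlyIncreasing : (ℕ → ℕ) → Set
StrictlyIncreasing u = u Preserves _<_ ⟶ _<_

strictlyIncreasing-suc : ∀ {u} → (∀ n → u n < u (suc n)) → StrictlyIncreasing u
strictlyIncreasing-suc step {m} {suc n} m<1+n with m≤n⇒m<n∨m≡n (m<1+n⇒m≤n m<1+n)
... | inj₁ m<n  = <-trans (strictlyIncreasing-suc step m<n) (step n)
... | inj₂ refl = step m

Image : (ℕ → ℕ) → ℕ → Set
Image u x = ∃ λ m → u m ≡ x

Sparse : (ℕ → ℕ) → Set
Sparse u = ∀ m {b} → ¬ Image u b → Adj (u m) b → m ≤ b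

module _ {u : ℕ → ℕ} (u-inc : StrictlyIncreasing u) where

  increasing⇒monotone : ∀ {m n} → m ≤ n → u m ≤ u n
  increasing⇒monotone m≤n with m≤n⇒m<n∨m≡n m≤n
  ... | inj₁ m<n  = <⇒≤ (u-inc m<n)
  ... | inj₂ refl = ≤-refl

  increasing⇒reflects< : ∀ {m n} → u m < u n → m < n
  increasing⇒reflects< {m} {n} um<un with <-cmp m n
  ... | tri< m<n _ _ = m<n
  ... | tri≈ _ refl _ = contradiction um<un (<-irrefl refl)
  ... | tri> _ _ n<m = contradiction um<un (<-asym (u-inc n<m))

  increasing⇒injective : ∀ {m n} → u m ≡ u n → m ≡ n
  increasing⇒injective {m} {n} um≡un with <-cmp m n
  ... | tri< m<n _ _ = contradiction um≡un (<⇒≢ (u-inc m<n))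
  ... | tri≈ _ m≡n _ = m≡n
  ... | tri> _ _ n<m = contradiction (sym um≡un) (<⇒≢ (u-inc n<m))

  increasing⇒inflationary : ∀ n → n ≤ u n
  increasing⇒inflationary zero    = z≤n
  increasing⇒inflationary (suc n) = ≤-<-trans (increasing⇒inflationary n) (u-inc (n<1+n n))

  increasing-image? : ∀ x → Dec (Image u x)
  increasing-image? x with anyUpTo? (λ m → u m ≟ x) (suc x)
  ... | yes (m , _ , um≡x) = yes (m , um≡x)
  ... | no  ¬bounded      = no λ (m , um≡x) →
    ¬bounded (m , s≤s (subst (m ≤_) um≡x (increasing⇒inflationary m)) , um≡x)

  pushforward : (ℕ → Bool) → ℕ → Bool
  pushforward b x with increasing-image? x
  ... | yes (n , _) = b n
  ... | no  _       = false

  pushforward-image : ∀ b n → pushforward b (u n) ≡ b n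
  pushforward-image b n with increasing-image? (u n)
  ... | yes (m , um≡un) = cong b (increasing⇒injective um≡un)
  ... | no  un∉         = contradiction (n , refl) un∉

  pushforward-outside : ∀ b {x} → ¬ Image u x → pushforward b x ≡ false
  pushforward-outside b {x} x∉ with increasing-image? x
  ... | yes x∈ = contradiction x∈ x∉
  ... | no  _  = refl

  pushforward⇒image : ∀ b {x} → pushforward b x ≡ true → Image u x
  pushforward⇒image b {x} _ with increasing-image? x
  ... | yes x∈ = x∈

image⊆⇒≥ : ∀ {u v} → StrictlyIncreasing u → StrictlyIncreasing v →
           (∀ m → Image v (u m)) → ∀ n → v n ≤ u n
image⊆⇒≥ {u} {v} u-inc v-inc u⊆v n = begin
  v n        ≤⟨ increasing⇒monotone v-inc (increasing⇒inflationary σ-inc n) ⟩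
  v (σ n)    ≡⟨ proj₂ (u⊆v n) ⟩
  u n        ∎
  where
  open ≤-Reasoning
  σ : ℕ → ℕ
  σ = proj₁ ∘ u⊆v
  σ-inc : StrictlyIncreasing σ
  σ-inc {m} {n} m<n = increasing⇒reflects< v-inc
    (subst₂ _<_ (sym (proj₂ (u⊆v m))) (sym (proj₂ (u⊆v n))) (u-inc m<n))

sameImage⇒≗ : ∀ {u v} → StrictlyIncreasing u → StrictlyIncreasing v →
              (∀ m → Image v (u m)) → (∀ m → Image u (v m)) → ∀ n → u n ≡ v n
sameImage⇒≗ u-inc v-inc u⊆v v⊆u n =
  ≤-antisym (image⊆⇒≥ v-inc u-inc v⊆u n) (image⊆⇒≥ u-inc v-inc u⊆v n)

markDigit : Bool → ℕ
markDigit false = 1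
markDigit true  = 2

markDigit%4 : ∀ b → markDigit b % 4 ≡ markDigit b
markDigit%4 false = refl
markDigit%4 true  = refl

markDigit-injective : ∀ {b c} → markDigit b ≡ markDigit c → b ≡ c
markDigit-injective {false} {false} _ = refl
markDigit-injective {true}  {true}  _ = refl

module Embedding (R : ℕ → ℕ → Set) (R-irrefl : ∀ a → ¬ R a a) (R? : Decidable R)
                 (mark : ℕ → Bool) where

  -- The base-4 digits of vertex n: the edge code of R between m and n at position vertex m
  -- (m < n), the marker of n at position markPos n = 3 + vertex (n - 1), and 0 elsewhere.
  -- Kept abstract since unfolding it during conversion checking is prohibitively slow.
  abstract
    code : ℕ → ℕ → ℕ
    code m n = edgeCode (R? m n) (R? n m)

    mutual
      vertex : ℕ → ℕ
      vertex n = fromDigits (suc (markPos n)) (digitOf n)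

      markPos : ℕ → ℕ
      markPos zero    = 0
      markPos (suc n) = 3 + vertex n

      digitOf : ℕ → ℕ → ℕ
      digitOf n k with k ≟ markPos n
      ... | yes _ = markDigit (mark n)
      ... | no  _ = scan n n k

      scan : ℕ → ℕ → ℕ → ℕ
      scan zero    n k = 0
      scan (suc j) n k with vertex j ≟ k
      ... | yes _ = code j n
      ... | no  _ = scan j n k

    digit-markPos : ∀ n → digit (markPos n) (vertex n) ≡ markDigit (mark n)
    digit-markPos n = trans (digit-fromDigits (suc (markPos n)) (digitOf n) ≤-refl) digitOf-markPos
      where
      digitOf-markPos : digitOf n (markPos n) % 4 ≡ markDigit (mark n)
      digitOf-markPos with markPos n ≟ markPos n
      ... | yes _ = markDigit%4 (mark n)
      ... | no  ≢ = contradiction refl ≢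

    markPos<vertex : ∀ n → markPos n < vertex n
    markPos<vertex n =
      digit≢0⇒< (markPos n) (vertex n) (markDigit≢0 ∘ trans (sym (digit-markPos n)))
      where
      markDigit≢0 : markDigit (mark n) ≢ 0
      markDigit≢0 with mark n
      ... | false = λ ()
      ... | true  = λ ()

    vertex-gap : ∀ n → 3 + vertex n < vertex (suc n)
    vertex-gap n = markPos<vertex (suc n)

    vertex-increasing : StrictlyIncreasing vertex
    vertex-increasing =
      strictlyIncreasing-suc λ n → ≤-<-trans (m≤n+m (vertex n) 3) (vertex-gap n)

    markPos-zero : markPos 0 ≡ 0
    markPos-zero = refl

    markPos-suc : ∀ n → markPos (suc n) ≡ 3 + vertex n
    markPos-suc n = refl

    vertex<markPos : ∀ {m n} → m < n → vertex m < markPos n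
    vertex<markPos {m} {suc n} m<1+n =
      ≤-<-trans (increasing⇒monotone vertex-increasing (m<1+n⇒m≤n m<1+n))
                (m<n+m (vertex n) {3} (s≤s z≤n))

    n≤markPos : ∀ n → n ≤ markPos n
    n≤markPos zero    = z≤n
    n≤markPos (suc n) =
      ≤-<-trans (increasing⇒inflationary vertex-increasing n) (m<n+m (vertex n) {3} (s≤s z≤n))

    gap-∉ : ∀ n k → 0 < k → k ≤ 3 → ¬ Image vertex (k + vertex n)
    gap-∉ n k 0<k k≤3 (m , vm≡k+vn) with m ≤? n
    ... | yes m≤n = <-irrefl vm≡k+vn
          (≤-<-trans (increasing⇒monotone vertex-increasing m≤n) (m<n+m (vertex n) 0<k))
    ... | no  m≰n = <-irrefl (sym vm≡k+vn)
          (<-≤-trans (≤-<-trans (+-monoˡ-≤ (vertex n) k≤3) (vertex-gap n))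
                     (increasing⇒monotone vertex-increasing (≰⇒> m≰n)))

    scan-miss : ∀ j n k → (∀ m → m < j → vertex m ≢ k) → scan j n k ≡ 0
    scan-miss zero    n k _    = refl
    scan-miss (suc j) n k miss with vertex j ≟ k
    ... | yes vj≡k = contradiction vj≡k (miss j ≤-refl)
    ... | no  _    = scan-miss j n k (λ m m<j → miss m (m<n⇒m<1+n m<j))

    scan-hit : ∀ j n {m} → m < j → scan j n (vertex m) ≡ code m n
    scan-hit (suc j) n {m} m<1+j with vertex j ≟ vertex m
    ... | yes vj≡vm = cong (λ i → code i n) (increasing⇒injective vertex-increasing vj≡vm)
    ... | no  vj≢vm with m≤n⇒m<n∨m≡n (m<1+n⇒m≤n m<1+j)
    ...   | inj₁ m<j  = scan-hit j n m<j
    ...   | inj₂ refl = contradiction refl vj≢vm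

    digit-vertex-vertex : ∀ {m n} → m < n → digit (vertex m) (vertex n) ≡ code m n
    digit-vertex-vertex {m} {n} m<n =
      trans (digit-fromDigits _ (digitOf n) (m<n⇒m<1+n (vertex<markPos m<n))) digitOf-vertex
      where
      digitOf-vertex : digitOf n (vertex m) % 4 ≡ code m n
      digitOf-vertex with vertex m ≟ markPos n
      ... | yes vm≡markPos = contradiction vm≡markPos (<⇒≢ (vertex<markPos m<n))
      ... | no  _          = trans (cong (_% 4) (scan-hit n n m<n)) (edgeCode%4 (R? m n) (R? n m))

    digit-vertex-outside : ∀ n {k} → ¬ Image vertex k → k ≢ markPos n →
                           digit k (vertex n) ≡ 0
    digit-vertex-outside n {k} k∉ k≢markPos with k <? suc (markPos n)
    ... | no  k≮ = digit-fromDigits-≥ _ (digitOf n) (≮⇒≥ k≮)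
    ... | yes k< = trans (digit-fromDigits _ (digitOf n) k<) digitOf-outside
      where
      digitOf-outside : digitOf n k % 4 ≡ 0
      digitOf-outside with k ≟ markPos n
      ... | yes k≡markPos = contradiction k≡markPos k≢markPos
      ... | no  _         = cong (_% 4) (scan-miss n n k (λ m _ vm≡k → k∉ (m , vm≡k)))

    vertex-sparse : Sparse vertex
    vertex-sparse m {b} b∉ adj with Adj⇒digit≢0 adj
    ... | inj₁ (vm<b , _) = ≤-trans (increasing⇒inflationary vertex-increasing m) (<⇒≤ vm<b)
    ... | inj₂ (_ , digit≢0) with b ≟ markPos m
    ...   | yes refl = n≤markPos m
    ...   | no  b≢   = contradiction (digit-vertex-outside m b∉ b≢) digit≢0

    vertex-preserves : ∀ {a b} → R a b → EdgeD (vertex a) (vertex b)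
    vertex-preserves {a} {b} Rab with <-cmp a b
    ... | tri< a<b _ _ = inj₁ (vertex-increasing a<b , subst Forward (sym (digit-vertex-vertex a<b))
                                           (forward-edgeCode⁺ (R? a b) (R? b a) Rab))
    ... | tri≈ _ refl _ = contradiction Rab (R-irrefl a)
    ... | tri> _ _ b<a = inj₂ (vertex-increasing b<a , subst Backward (sym (digit-vertex-vertex b<a))
                                           (backward-edgeCode⁺ (R? b a) (R? a b) Rab))

    vertex-reflects : ∀ {a b} → EdgeD (vertex a) (vertex b) → R a b
    vertex-reflects {a} {b} (inj₁ (va<vb , fwd)) = forward-edgeCode⁻ (R? a b) (R? b a)
      (subst Forward (digit-vertex-vertex (increasing⇒reflects< vertex-increasing va<vb)) fwd)
    vertex-reflects {a} {b} (inj₂ (vb<va , bwd)) = backward-edgeCode⁻ (R? b a) (R? a b)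
      (subst Backward (digit-vertex-vertex (increasing⇒reflects< vertex-increasing vb<va)) bwd)

maxBelow : (ℕ → ℕ) → ℕ → ℕ
maxBelow p zero    = 0
maxBelow p (suc n) = maxBelow p n ⊔ p n

≤-maxBelow : ∀ p {m n} → m < n → p m ≤ maxBelow p n
≤-maxBelow p {m} {suc n} m<1+n with m≤n⇒m<n∨m≡n (m<1+n⇒m≤n m<1+n)
... | inj₁ m<n  = ≤-trans (≤-maxBelow p m<n) (m≤m⊔n (maxBelow p n) (p n))
... | inj₂ refl = m≤n⊔m (maxBelow p m) (p m)

stepDown : Bool → ℕ → ℕ
stepDown true  x = pred x
stepDown false x = x

stepDown-≤ : ∀ c {x} → stepDown c x ≤ x
stepDown-≤ true  = pred[n]≤n
stepDown-≤ false = ≤-refl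

≤-suc-stepDown : ∀ c x → x ≤ suc (stepDown c x)
≤-suc-stepDown true  zero    = z≤n
≤-suc-stepDown true  (suc x) = ≤-refl
≤-suc-stepDown false x       = n≤1+n x

stepDown-< : ∀ c d {a b} → a < b → (d ≡ true → suc a ≢ b) → stepDown c a < stepDown d b
stepDown-< c false a<b _ = ≤-<-trans (stepDown-≤ c) a<b
stepDown-< c true  {a} {suc b} a<1+b 1+a≢ =
  ≤-<-trans (stepDown-≤ c) (≤∧≢⇒< (m<1+n⇒m≤n a<1+b) (1+a≢ refl ∘ cong suc))

-- A non-image vertex x goes to hub (level x), adjacent in both directions to every p m with
-- m ≤ level x + 1 and to every hub of smaller level; sparseness of g and the hypotheses on
-- level ensure that every edge at x has its other end among these.
module Extension {g : ℕ → ℕ} (g-inc : StrictlyIncreasing g) (g-sparse : Sparse g)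
                 (p : ℕ → ℕ) (p-hom : ∀ {m n} → EdgeD (g m) (g n) → EdgeD (p m) (p n))
                 (level : ℕ → ℕ) (≤-suc-level : ∀ x → x ≤ suc (level x))
                 (level-increasing : ∀ {a b} → Adj a b → a < b → level a < level b) where

  bound : ℕ → ℕ
  bound zero    = suc (maxBelow p 2)
  bound (suc y) = suc (common (bound y) ⊔ maxBelow p (3 + y))

  hub : ℕ → ℕ
  hub y = common (bound y)

  p<bound : ∀ {m} y → m ≤ suc y → p m < bound y
  p<bound zero    m≤1   = s≤s (≤-maxBelow p (s≤s m≤1))
  p<bound (suc y) m≤2+y = s≤s (≤-trans (≤-maxBelow p (s≤s m≤2+y)) (m≤n⊔m (hub y) _))

  bound<hub : ∀ y → bound y < hub y
  bound<hub y = <beyond (bound y) 3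

  hub<bound-suc : ∀ y → hub y < bound (suc y)
  hub<bound-suc y = s≤s (m≤m⊔n (hub y) _)

  bound-increasing : StrictlyIncreasing bound
  bound-increasing = strictlyIncreasing-suc λ y → <-trans (bound<hub y) (hub<bound-suc y)

  hub<bound : ∀ {y y′} → y < y′ → hub y < bound y′
  hub<bound {y} y<y′ = <-≤-trans (hub<bound-suc y) (increasing⇒monotone bound-increasing y<y′)

  hub-increasing : StrictlyIncreasing hub
  hub-increasing y<y′ = <-trans (hub<bound y<y′) (bound<hub _)

  ext : ℕ → ℕ
  ext x with increasing-image? g-inc x
  ... | yes (m , _) = p m
  ... | no  _       = hub (level x)

  ext-image : ∀ m → ext (g m) ≡ p m
  ext-image m with increasing-image? g-inc (g m)
  ... | yes (k , gk≡gm) = cong p (increasing⇒injective g-inc gk≡gm)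
  ... | no  gm∉         = contradiction (m , refl) gm∉

  ext-outside : ∀ {x} → ¬ Image g x → ext x ≡ hub (level x)
  ext-outside {x} x∉ with increasing-image? g-inc x
  ... | yes x∈ = contradiction x∈ x∉
  ... | no  _  = refl

  ext-hom : ∀ a b → EdgeD a b → EdgeD (ext a) (ext b)
  ext-hom a b e with increasing-image? g-inc a | increasing-image? g-inc b
  ... | yes (m , refl) | yes (n , refl) = p-hom e
  ... | yes (m , refl) | no b∉ =
    proj₁ (common-adj _ (p<bound (level b)
      (≤-trans (g-sparse m b∉ (inj₁ e)) (≤-suc-level b))))
  ... | no a∉ | yes (n , refl) =
    proj₂ (common-adj _ (p<bound (level a)
      (≤-trans (g-sparse n a∉ (inj₂ e)) (≤-suc-level a))))
  ... | no _ | no _ with <-cmp a b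
  ...   | tri< a<b _ _  = proj₁ (common-adj _ (hub<bound (level-increasing (inj₁ e) a<b)))
  ...   | tri≈ _ refl _ = contradiction e (EdgeD-irrefl a)
  ...   | tri> _ _ b<a  = proj₂ (common-adj _ (hub<bound (level-increasing (inj₂ e) b<a)))

  extension : End
  extension = record { fun = ext ; hom = ext-hom }

idᴱ : End
idᴱ = record { fun = λ x → x ; hom = λ _ _ e → e }

𝓛-intro : ∀ {f g} a b → (a · g) ≈ f → (b · f) ≈ g → f 𝓛 g
𝓛-intro a b ag≈f bf≈g =
    (λ h (x , h≈xf) → x · a , λ z → trans (h≈xf z) (cong (fun x) (sym (ag≈f z))))
  , (λ h (x , h≈xg) → x · b , λ z → trans (h≈xg z) (cong (fun x) (sym (bf≈g z))))

𝓡-intro : ∀ {f g} a b → (g · a) ≈ f → (f · b) ≈ g → f 𝓡 g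
𝓡-intro a b ga≈f fb≈g =
    (λ h (x , h≈fx) → a · x , λ z → trans (h≈fx z) (sym (ga≈f (fun x z))))
  , (λ h (x , h≈gx) → b · x , λ z → trans (h≈gx z) (sym (fb≈g (fun x z))))

𝓛-refl : ∀ f → f 𝓛 f
𝓛-refl f = 𝓛-intro {f} {f} idᴱ idᴱ (λ _ → refl) (λ _ → refl)

𝓡-refl : ∀ f → f 𝓡 f
𝓡-refl f = 𝓡-intro {f} {f} idᴱ idᴱ (λ _ → refl) (λ _ → refl)

𝓛⇒kernel⊆ : ∀ {f g} → f 𝓛 g → ∀ {x y} → fun g x ≡ fun g y → fun f x ≡ fun f y
𝓛⇒kernel⊆ {f} (f⊆g , _) {x} {y} gx≡gy with f⊆g f (idᴱ , λ _ → refl)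
... | a , f≈ag = trans (f≈ag x) (trans (cong (fun a) gx≡gy) (sym (f≈ag y)))

𝓡⇒image⊆ : ∀ {f g} → f 𝓡 g → ∀ x → Image (fun g) (fun f x)
𝓡⇒image⊆ {f} (f⊆g , _) x with f⊆g f (idᴱ , λ _ → refl)
... | a , f≈ga = fun a x , sym (f≈ga x)

module BackAndForth (lem : ExcludedMiddle 0ℓ) (Γ : Digraph) (Γ-countable : Countable Γ)
                    (Γ-ac : AlgClosed Γ) where

  enum : ℕ → V Γ
  enum = proj₁ Γ-countable

  Approximation : Set
  Approximation = List (ℕ × V Γ)

  record PartialHom (π : Approximation) : Set where
    field
      functional  : ∀ {x v v′} → (x , v) ∈ π → (x , v′) ∈ π → v ≡ v′
      injective   : ∀ {x x′ v} → (x , v) ∈ π → (x′ , v) ∈ π → x ≡ x′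
      homomorphic : ∀ {x y v w} → (x , v) ∈ π → (y , w) ∈ π → EdgeD x y → E Γ v w
  open PartialHom

  partialHom-[] : PartialHom []
  partialHom-[] = record { functional = λ () ; injective = λ () ; homomorphic = λ () }

  partialHom-∷ : ∀ {π a h} → PartialHom π →
                 (∀ v → (a , v) ∉ π) → (∀ x → (x , h) ∉ π) →
                 (∀ {x v} → (x , v) ∈ π → (EdgeD a x → E Γ h v) × (EdgeD x a → E Γ v h)) →
                 PartialHom ((a , h) ∷ π)
  partialHom-∷ {π} {a} {h} π-hom a∉ h∉ edges = record
    { functional = fun′ ; injective = inj′ ; homomorphic = hom′ }
    where
    π′ : Approximation
    π′ = (a , h) ∷ π
    fun′ : ∀ {x v v′} → (x , v) ∈ π′ → (x , v′) ∈ π′ → v ≡ v′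
    fun′ (here refl) (here refl) = refl
    fun′ (here refl) (there q)   = contradiction q (a∉ _)
    fun′ (there p)   (here refl) = contradiction p (a∉ _)
    fun′ (there p)   (there q)   = functional π-hom p q
    inj′ : ∀ {x x′ v} → (x , v) ∈ π′ → (x′ , v) ∈ π′ → x ≡ x′
    inj′ (here refl) (here refl) = refl
    inj′ (here refl) (there q)   = contradiction q (h∉ _)
    inj′ (there p)   (here refl) = contradiction p (h∉ _)
    inj′ (there p)   (there q)   = injective π-hom p q
    hom′ : ∀ {x y v w} → (x , v) ∈ π′ → (y , w) ∈ π′ → EdgeD x y → E Γ v w
    hom′ (here refl) (here refl) e = contradiction e (EdgeD-irrefl a)
    hom′ (here refl) (there q)   e = proj₁ (edges q) e
    hom′ (there p)   (here refl) e = proj₂ (edges p) e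
    hom′ (there p)   (there q)   e = homomorphic π-hom p q e

  Dom : ℕ → Approximation → Set
  Dom x π = ∃ λ v → (x , v) ∈ π

  Ran : V Γ → Approximation → Set
  Ran v π = ∃ λ x → (x , v) ∈ π

  newcomer : Approximation → V Γ
  newcomer π = proj₁ (Γ-ac (map proj₂ π))

  newcomer-adj : ∀ {π : Approximation} {x v} → (x , v) ∈ π →
                 E Γ v (newcomer π) × E Γ (newcomer π) v
  newcomer-adj {π} = lookup (map⁻ (proj₂ (Γ-ac (map proj₂ π))))

  fresh : Approximation → ℕ
  fresh π = isolated (suc (max 0 (map proj₁ π)))

  ∈⇒≤max : ∀ {π : Approximation} {x v} → (x , v) ∈ π → x ≤ max 0 (map proj₁ π)
  ∈⇒≤max {π} = lookup (map⁻ (xs≤max 0 (map proj₁ π)))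

  fresh-∉ : ∀ {π : Approximation} v → (fresh π , v) ∉ π
  fresh-∉ v q = <-irrefl refl (<-trans (s≤s (∈⇒≤max q)) (<beyond _ 0))

  fresh-¬Adj : ∀ {π : Approximation} {x v} → (x , v) ∈ π → ¬ Adj x (fresh π)
  fresh-¬Adj q = isolated-¬Adj _ (s≤s (∈⇒≤max q))

  forth : ℕ → Approximation → Approximation
  forth n π with lem {Dom n π}
  ... | yes _ = π
  ... | no  _ = (n , newcomer π) ∷ π

  back : ℕ → Approximation → Approximation
  back n π with lem {Ran (enum n) π}
  ... | yes _ = π
  ... | no  _ = (fresh π , enum n) ∷ π

  forth-partialHom : ∀ n {π} → PartialHom π → PartialHom (forth n π)
  forth-partialHom n {π} π-hom with lem {Dom n π}
  ... | yes _ = π-hom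
  ... | no  n∉ = partialHom-∷ π-hom (λ v q → n∉ (v , q))
    (λ x q → irrefl Γ _ (proj₁ (newcomer-adj q)))
    (λ q → (λ _ → proj₂ (newcomer-adj q)) , (λ _ → proj₁ (newcomer-adj q)))

  back-partialHom : ∀ n {π} → PartialHom π → PartialHom (back n π)
  back-partialHom n {π} π-hom with lem {Ran (enum n) π}
  ... | yes _ = π-hom
  ... | no  e∉ = partialHom-∷ π-hom fresh-∉ (λ x q → e∉ (x , q))
    (λ q → (λ e → contradiction (inj₂ e) (fresh-¬Adj q))
         , (λ e → contradiction (inj₁ e) (fresh-¬Adj q)))

  forth-⊇ : ∀ n π → π ⊆ forth n π
  forth-⊇ n π with lem {Dom n π}
  ... | yes _ = λ q → q
  ... | no  _ = there

  back-⊇ : ∀ n π → π ⊆ back n π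
  back-⊇ n π with lem {Ran (enum n) π}
  ... | yes _ = λ q → q
  ... | no  _ = there

  forth-dom : ∀ n π → Dom n (forth n π)
  forth-dom n π with lem {Dom n π}
  ... | yes n∈ = n∈
  ... | no  _  = _ , here refl

  back-ran : ∀ n π → Ran (enum n) (back n π)
  back-ran n π with lem {Ran (enum n) π}
  ... | yes e∈ = e∈
  ... | no  _  = _ , here refl

  stage : ℕ → Approximation
  stage zero    = []
  stage (suc n) = back n (forth n (stage n))

  stage-partialHom : ∀ n → PartialHom (stage n)
  stage-partialHom zero    = partialHom-[]
  stage-partialHom (suc n) = back-partialHom n (forth-partialHom n (stage-partialHom n))

  stage-mono : ∀ {m n} → m ≤ n → stage m ⊆ stage n
  stage-mono = go ∘ ≤⇒≤′
    where
    go : ∀ {m n} → m ≤′ n → stage m ⊆ stage n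
    go ≤′-refl          = λ q → q
    go (≤′-step {n} m≤n) = back-⊇ n _ ∘ forth-⊇ n _ ∘ go m≤n

  Graph : ℕ → V Γ → Set
  Graph x v = ∃ λ n → (x , v) ∈ stage n

  module _ {x y v w} (xv : Graph x v) (yw : Graph y w) where
    private
      n : ℕ
      n = proj₁ xv ⊔ proj₁ yw
      π-hom : PartialHom (stage n)
      π-hom = stage-partialHom n
      p′ : (x , v) ∈ stage n
      p′ = stage-mono (m≤m⊔n (proj₁ xv) (proj₁ yw)) (proj₂ xv)
      q′ : (y , w) ∈ stage n
      q′ = stage-mono (m≤n⊔m (proj₁ xv) (proj₁ yw)) (proj₂ yw)

    graph-functional : x ≡ y → v ≡ w
    graph-functional refl = functional π-hom p′ q′

    graph-injective : v ≡ w → x ≡ y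
    graph-injective refl = injective π-hom p′ q′

    graph-homomorphic : EdgeD x y → E Γ v w
    graph-homomorphic = homomorphic π-hom p′ q′

  graph-total : ∀ x → ∃ λ v → Graph x v
  graph-total x with forth-dom x (stage x)
  ... | v , q = v , suc x , back-⊇ x _ q

  graph-onto : ∀ w → ∃ λ x → Graph x w
  graph-onto w with proj₂ Γ-countable w
  ... | j , refl with back-ran j (forth j (stage j))
  ...   | x , q = x , suc j , q

  φ : ℕ → V Γ
  φ x = proj₁ (graph-total x)

  ψ : V Γ → ℕ
  ψ w = proj₁ (graph-onto w)

  φ-hom : ∀ {x y} → EdgeD x y → E Γ (φ x) (φ y)
  φ-hom {x} {y} = graph-homomorphic (proj₂ (graph-total x)) (proj₂ (graph-total y))

  φ∘ψ : ∀ w → φ (ψ w) ≡ w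
  φ∘ψ w = graph-functional (proj₂ (graph-total (ψ w))) (proj₂ (graph-onto w)) refl

  ψ∘φ : ∀ x → ψ (φ x) ≡ x
  ψ∘φ x = graph-injective (proj₂ (graph-onto (φ x))) (proj₂ (graph-total x)) refl

module Construction (lem : ExcludedMiddle 0ℓ) (Γ : Digraph) (Γ-countable : Countable Γ)
                    (Γ-ac : AlgClosed Γ) where

  open BackAndForth lem Γ Γ-countable Γ-ac using (φ; ψ; φ-hom; φ∘ψ; ψ∘φ)

  Eᵩ : ℕ → ℕ → Set
  Eᵩ a b = E Γ (φ a) (φ b)

  module Copy (s : ℕ → Bool) = Embedding Eᵩ (λ a → irrefl Γ (φ a)) (λ _ _ → lem) s

  copy : (ℕ → Bool) → End
  copy s = record { fun = Copy.vertex s ; hom = λ _ _ → Copy.vertex-preserves s ∘ φ-hom }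

  f : End
  f = copy (λ _ → false)

  f-injective : Injective f
  f-injective _ _ = increasing⇒injective (Copy.vertex-increasing _)

  image≅Γ : ImageSubgraph f ≅ Γ
  image≅Γ = record
    { to      = λ (_ , x , _) → φ x
    ; from    = λ w → fun f (ψ w) , ψ w , refl
    ; from∘to = λ { (_ , x , refl) → cong (λ z → fun f z , z , refl) (ψ∘φ x) }
    ; to∘from = φ∘ψ
    ; pres    = λ { (_ , x , refl) (_ , y , refl) → Copy.vertex-reflects _ }
    ; refl'   = λ { (_ , x , refl) (_ , y , refl) → Copy.vertex-preserves _ }
    }

  regular⇒Γ≅D : Regular f → Γ ≅ D
  regular⇒Γ≅D (g , fgf≈f) = record
    { to      = ψ
    ; from    = φ
    ; from∘to = φ∘ψ
    ; to∘from = ψ∘φ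
    ; pres    = λ u v → reflects ∘ subst₂ (E Γ) (sym (φ∘ψ u)) (sym (φ∘ψ v))
    ; refl'   = λ u v → subst₂ (E Γ) (φ∘ψ u) (φ∘ψ v) ∘ φ-hom
    }
    where
    gf≗id : ∀ x → fun g (fun f x) ≡ x
    gf≗id x = f-injective _ _ (fgf≈f x)
    reflects : ∀ {a b} → Eᵩ a b → EdgeD a b
    reflects {a} {b} = subst₂ EdgeD (gf≗id a) (gf≗id b) ∘ hom g _ _ ∘ Copy.vertex-preserves _

  module Transfer (s t : ℕ → Bool) =
    Extension (Copy.vertex-increasing s) (Copy.vertex-sparse s) (Copy.vertex t)
              (λ {m n} → Copy.vertex-preserves t {m} {n} ∘ Copy.vertex-reflects s)
              (λ x → x) n≤1+n (λ _ a<b → a<b)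

  copy-𝓛 : ∀ s t → copy s 𝓛 copy t
  copy-𝓛 s t = 𝓛-intro {copy s} {copy t} (Transfer.extension t s) (Transfer.extension s t)
                       (Transfer.ext-image t s) (Transfer.ext-image s t)

  copy-𝓡⇒≗ : ∀ s t → copy s 𝓡 copy t → ∀ n → s n ≡ t n
  copy-𝓡⇒≗ s t s𝓡t n = markDigit-injective (begin
    markDigit (s n)                             ≡⟨ Copy.digit-markPos s n ⟨
    digit (Copy.markPos s n) (Copy.vertex s n)  ≡⟨ cong₂ digit (markPos-≡ n) (vertex-≡ n) ⟩
    digit (Copy.markPos t n) (Copy.vertex t n)  ≡⟨ Copy.digit-markPos t n ⟩
    markDigit (t n)                             ∎)
    where
    open ≡-Reasoning
    vertex-≡ : ∀ n → Copy.vertex s n ≡ Copy.vertex t n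
    vertex-≡ = sameImage⇒≗ (Copy.vertex-increasing s) (Copy.vertex-increasing t)
                            (𝓡⇒image⊆ {copy s} {copy t} s𝓡t)
                            (𝓡⇒image⊆ {copy t} {copy s} (×-swap s𝓡t))
    markPos-≡ : ∀ n → Copy.markPos s n ≡ Copy.markPos t n
    markPos-≡ zero    = trans (Copy.markPos-zero s) (sym (Copy.markPos-zero t))
    markPos-≡ (suc n) = trans (Copy.markPos-suc s n)
                              (trans (cong (3 +_) (vertex-≡ n)) (sym (Copy.markPos-suc t n)))

  continuumMany𝓡 : ContinuumManyClassesIn𝓓 _𝓡_ f
  continuumMany𝓡 = copy , (λ s → f , copy-𝓛 s _ , 𝓡-refl f) , copy-𝓡⇒≗

  module Spread = Embedding EdgeD EdgeD-irrefl EdgeD? (λ _ → false)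
  open Spread using () renaming (vertex to spread)

  spreadᴱ : End
  spreadᴱ = record { fun = spread ; hom = λ _ _ → Spread.vertex-preserves }

  2+spread-increasing : StrictlyIncreasing (λ n → 2 + spread n)
  2+spread-increasing = +-monoʳ-< 2 ∘ Spread.vertex-increasing

  glued : (ℕ → Bool) → ℕ → Bool
  glued = pushforward 2+spread-increasing

  level : (ℕ → Bool) → ℕ → ℕ
  level s x = stepDown (glued s x) x

  level-increasing : ∀ s {a b} → Adj a b → a < b → level s a < level s b
  level-increasing s {a} {b} adj a<b =
    stepDown-< (glued s a) (glued s b) a<b λ glued≡true 1+a≡b →
      let n , 2+sn≡b = pushforward⇒image 2+spread-increasing s glued≡true
          a≡1+sn     = suc-injective (trans 1+a≡b (sym 2+sn≡b))
      in ¬Adj-1+n-2+n (spread n) (subst₂ Adj a≡1+sn (sym 2+sn≡b) adj)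

  glued-1+spread : ∀ s n → glued s (1 + spread n) ≡ false
  glued-1+spread s n = pushforward-outside 2+spread-increasing s λ (m , 2+sm≡1+sn) →
    Spread.gap-∉ m 1 (s≤s z≤n) (s≤s z≤n) (n , sym (suc-injective 2+sm≡1+sn))

  module Glue (s : ℕ → Bool) =
    Extension Spread.vertex-increasing Spread.vertex-sparse
              (λ z → z) (λ {m n} → Spread.vertex-reflects {m} {n})
              (level s) (λ x → ≤-suc-stepDown (glued s x) x) (level-increasing s)
  open Glue using (hub)

  β : (ℕ → Bool) → End
  β = Glue.extension

  β-1+spread : ∀ s n → fun (β s) (1 + spread n) ≡ hub s (1 + spread n)
  β-1+spread s n = trans (Glue.ext-outside s (Spread.gap-∉ n 1 (s≤s z≤n) (s≤s z≤n)))
                         (cong (λ c → hub s (stepDown c (1 + spread n))) (glued-1+spread s n))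

  β-2+spread : ∀ s n {b} → s n ≡ b → fun (β s) (2 + spread n) ≡ hub s (stepDown b (2 + spread n))
  β-2+spread s n sn≡b = trans (Glue.ext-outside s (Spread.gap-∉ n 2 (s≤s z≤n) (s≤s (s≤s z≤n))))
    (cong (λ c → hub s (stepDown c (2 + spread n)))
          (trans (pushforward-image 2+spread-increasing s n) sn≡b))

  glue : (ℕ → Bool) → End
  glue s = f · β s

  Glues : (ℕ → Bool) → ℕ → Set
  Glues s n = fun (glue s) (1 + spread n) ≡ fun (glue s) (2 + spread n)

  glues⁺ : ∀ s n → s n ≡ true → Glues s n
  glues⁺ s n sn≡true = cong (fun f) (trans (β-1+spread s n) (sym (β-2+spread s n sn≡true)))

  glue-separates : ∀ s n → s n ≡ false → ¬ Glues s n
  glue-separates s n sn≡false glue-eq =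
    1+n≢n (sym (increasing⇒injective (Glue.hub-increasing s) {1 + spread n} {2 + spread n}
      (trans (sym (β-1+spread s n)) (trans (f-injective _ _ glue-eq) (β-2+spread s n sn≡false)))))

  glues⁻ : ∀ s n → Glues s n → s n ≡ true
  glues⁻ s n glue-eq = ¬-not λ sn≡false → glue-separates s n sn≡false glue-eq

  glue-𝓡 : ∀ s → glue s 𝓡 f
  glue-𝓡 s = 𝓡-intro {glue s} {f} (β s) spreadᴱ (λ _ → refl) (cong (fun f) ∘ Glue.ext-image s)

  glue-𝓛⇒≗ : ∀ s t → glue s 𝓛 glue t → ∀ n → s n ≡ t n
  glue-𝓛⇒≗ s t s𝓛t n = ⇔→≡ (mk⇔
    (glues⁻ t n ∘ 𝓛⇒kernel⊆ {glue t} {glue s} (×-swap s𝓛t) ∘ glues⁺ s n)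
    (glues⁻ s n ∘ 𝓛⇒kernel⊆ {glue s} {glue t} s𝓛t ∘ glues⁺ t n))

  continuumMany𝓛 : ContinuumManyClassesIn𝓓 _𝓛_ f
  continuumMany𝓛 = glue , (λ s → glue s , 𝓛-refl (glue s) , glue-𝓡 s) , glue-𝓛⇒≗

theorem4p7 : ExcludedMiddle 0ℓ →
    (Γ : Digraph) → Countable Γ → AlgClosed Γ → ¬ (Γ ≅ D) →
    Σ End (λ f → Injective f × ¬ Regular f × (ImageSubgraph f ≅ Γ)
      × ContinuumManyClassesIn𝓓 _𝓡_ f × ContinuumManyClassesIn𝓓 _𝓛_ f)
theorem4p7 lem Γ Γ-countable Γ-ac Γ≇D =
  f , f-injective , Γ≇D ∘ regular⇒Γ≅D , image≅Γ , continuumMany𝓡 , continuumMany𝓛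
  where open Construction lem Γ Γ-countable Γ-ac
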